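{- Let $q$ be a prime power, let $m, n, d$ be positive integers, and suppose that $\Phi = (\phi_1,\dots, \phi_n) : \mathbb{F}_q^m \rightarrow \mathbb{F}_q^n$ is a polynomial map with each $\phi_i$ an $m$-variable polynomial over $\mathbb{F}_q$ of total degree $\leq d$. Suppose that $|\Phi^{ -1}(0)|$ is coprime to $q$. Then there is a polynomial $P \in \mathbb{F}_q[x_1,\dots, x_n]$, in which no variable appears with degree $> q - 1$, such that (1) $\deg P \leq (q - 1)\left(n - \frac{m}{d}\right)$; (2) $P$ is supported on $\operatorname{im}(\Phi)$, that is, $P(x) = 0$ for every $x \in \mathbb{F}_q^n \setminus \operatorname{im}(\Phi)$; (3) $P(0) \neq 0$.
   Context: $\deg P$ denotes the total degree of $P$, i.e. the maximum of $\alpha_1 + \dots + \alpha_n$ over monomials $x_1^{\alpha_1}\cdots x_n^{\alpha_n}$ appearing in $P$ with nonzero coefficient. -}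

module Defs where

open import Level using (Level; _⊔_) renaming (suc to lsuc)
open import Algebra.Bundles using (CommutativeRing)
open import Data.Nat using (ℕ; zero; suc; _<_; _≤_) renaming (_+_ to _+ℕ_)
open import Data.Nat.Primality using (Prime)
open import Data.Fin using (Fin)
open import Data.Fin.Properties using (all?)
open import Data.Vec using (Vec; []; _∷_; lookup)
open import Data.List using (List; []; _∷_; map; concatMap; filter; length; upTo; allFin)
open import Data.Product using (∃; _×_; _,_)
open import Relation.Nullary using (¬_)
open import Relation.Binary using (Decidable)
open import Relation.Binary.PropositionalEquality using (_≡_)
open import Data.Nat using (_^_)

IsPrimePower : ℕ → Set
IsPrimePower q = ∃ λ p → ∃ λ k → Prime p × q ≡ p ^ suc k

record FiniteField (c ℓ : Level) (q : ℕ) : Set (lsuc (c ⊔ ℓ)) where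
  field
    commutativeRing : CommutativeRing c ℓ
  open CommutativeRing commutativeRing public
  field
    _≟_             : Decidable _≈_
    1≉0             : ¬ (1# ≈ 0#)
    inverse         : ∀ x → ¬ (x ≈ 0#) → ∃ λ y → x * y ≈ 1#
    elem            : Fin q → Carrier
    elem-injective  : ∀ i j → elem i ≈ elem j → i ≡ j
    elem-surjective : ∀ x → ∃ λ i → elem i ≈ x

vecsOver : ∀ {a} {A : Set a} → List A → (m : ℕ) → List (Vec A m)
vecsOver xs zero    = [] ∷ []
vecsOver xs (suc m) = concatMap (λ v → map (λ x → x ∷ v) xs) (vecsOver xs m)

∣_∣ₑ : ∀ {m} → Vec ℕ m → ℕ
∣ [] ∣ₑ     = 0
∣ a ∷ α ∣ₑ = a +ℕ ∣ α ∣ₑ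

module _ {c ℓ q} (F : FiniteField c ℓ q) where
  open FiniteField F

  pow : Carrier → ℕ → Carrier
  pow x zero    = 1#
  pow x (suc k) = x * pow x k

  sumR : List Carrier → Carrier
  sumR []       = 0#
  sumR (x ∷ xs) = x + sumR xs

  monomial : ∀ {m} → Vec ℕ m → Vec Carrier m → Carrier
  monomial []      []      = 1#
  monomial (a ∷ α) (x ∷ xs) = pow x a * monomial α xs

  record Poly (m : ℕ) : Set (c ⊔ ℓ) where
    field
      coeff   : Vec ℕ m → Carrier
      bound   : ℕ
      support : ∀ α → ¬ (coeff α ≈ 0#) → ∀ j → lookup α j ≤ bound
  open Poly public

  -- evaluation: Σ_α coeff(α) x^α, summing over the box containing the support
  eval : ∀ {m} → Poly m → Vec Carrier m → Carrier
  eval P x = sumR (map (λ α → coeff P α * monomial α x) (vecsOver (upTo (suc (bound P))) _))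

  DegreeAtMost : ∀ {m} → Poly m → ℕ → Set ℓ
  DegreeAtMost P D = ∀ α → ¬ (coeff P α ≈ 0#) → ∣ α ∣ₑ ≤ D

  IndividualDegreeAtMost : ∀ {m} → Poly m → ℕ → Set ℓ
  IndividualDegreeAtMost P e = ∀ α → ¬ (coeff P α ≈ 0#) → ∀ j → lookup α j ≤ e

  points : (m : ℕ) → List (Vec Carrier m)
  points m = vecsOver (map elem (allFin q)) m

  zeroCount : ∀ {m n} → (Fin n → Poly m) → ℕ
  zeroCount {m} Φ = length (filter (λ x → all? (λ i → eval (Φ i) x ≟ 0#)) (points m))

  InImage : ∀ {m n} → (Fin n → Poly m) → Vec Carrier n → Set (c ⊔ ℓ)
  InImage {m} Φ y = ∃ λ (x : Vec Carrier m) → ∀ i → eval (Φ i) x ≈ lookup y i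

  zeroVec : ∀ n → Vec Carrier n
  zeroVec zero    = []
  zeroVec (suc n) = 0# ∷ zeroVec n

-- With K = q - 1, take P(y) = ∑_{x ∈ F^m} ∏_i (1 - (y_i - φ_i(x))^K). By Fermat, 1 - z^K is the
-- indicator of z = 0, so P(y) counts the x with Φ(x) = y: it vanishes off im Φ, and P(0) = |Φ⁻¹(0)| · 1
-- is nonzero because q · 1 = 0 and |Φ⁻¹(0)| is coprime to q. The i-th factor has degree ≤ K in y_i and,
-- giving y the weight d, weighted degree ≤ d K; so the coefficient of y^β is a sum over F^m of a
-- polynomial of degree ≤ n d K - d |β| in x. As ∑_{x ∈ F^m} x^α = 0 unless |α| ≥ m K (otherwise some
-- power sum ∑_t t^(α_j) with α_j < K vanishes), a nonzero coefficient forces d |β| + m K ≤ n d K.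

module Submission where

open import Defs
open import Level using (Level)
open import Algebra.Bundles using (CommutativeMonoid; CommutativeRing)
import Algebra.Properties.CommutativeMonoid.Sum as FinSum
import Algebra.Properties.CommutativeSemigroup as CommutativeSemigroupProperties
open import Data.Fin using (Fin; zero; suc)
open import Data.Fin.Properties using (suc-injective; any?; all?; ¬∀⟶∃¬)
open import Data.Fin.Permutation using (Permutation′; permutation; _⟨$⟩ʳ_)
open import Data.Maybe using (nothing)
open import Data.Product using (∃; _,_; proj₁; proj₂)
open import Data.List using (List; []; _∷_; map; concatMap; _++_; filter; length; tabulate; allFin; applyUpTo; upTo)
open import Data.List.Properties using (length-map; length-tabulate)
open import Data.List.Relation.Unary.All as All using (All; []; _∷_)
import Data.List.Relation.Unary.All.Properties as AllP
open import Data.List.Relation.Unary.AllPairs as AllPairs using (AllPairs; []; _∷_)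
import Data.List.Relation.Unary.AllPairs.Properties as AllPairsP
open import Data.List.Relation.Unary.Unique.Propositional.Properties using (allFin⁺)
open import Data.Nat as ℕ using (ℕ; zero; suc; _∸_; _≤_; _<_; z≤n; s≤s)
import Data.Nat.Properties as ℕ
open import Data.Nat.Properties using (∸-monoˡ-≤; <⇒≱; m<n⇒0<n∸m)
open import Data.Nat.Coprimality using (Coprime; coprime-Bézout)
open import Data.Nat.GCD using (module Bézout)
open import Data.Vec using (Vec; []; _∷_; lookup; replicate; zipWith)
open import Function using (_∘_; id)
open import Relation.Nullary using (¬_; ¬?; yes; no; contradiction)
open import Relation.Nullary.Decidable using (decidable-stable)
open import Relation.Unary using (Pred; Decidable)
open import Tactic.RingSolver using (solve-∀)
import Data.Nat.Tactic.RingSolver as ℕ-Solver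
open import Tactic.RingSolver.Core.AlmostCommutativeRing using (AlmostCommutativeRing; fromCommutativeRing)
open import Relation.Binary.PropositionalEquality as ≡ using (_≡_; _≢_)

private
  variable
    a b : Level
    A B : Set a

-- Big operators over lists

module ListFold {c ℓ} (M : CommutativeMonoid c ℓ) where
  open CommutativeMonoid M
  open FinSum M using (sum; sum-cong-≋; sum-permute)
  open CommutativeSemigroupProperties commutativeSemigroup using (interchange)
  open import Relation.Binary.Reasoning.Setoid setoid

  foldMap : (A → Carrier) → List A → Carrier
  foldMap f []       = ε
  foldMap f (x ∷ xs) = f x ∙ foldMap f xs

  foldMap-cong : ∀ {f g : A → Carrier} xs → (∀ x → f x ≈ g x) → foldMap f xs ≈ foldMap g xs
  foldMap-cong []       f≈g = refl
  foldMap-cong (x ∷ xs) f≈g = ∙-cong (f≈g x) (foldMap-cong xs f≈g)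

  foldMap-++ : ∀ (f : A → Carrier) xs ys → foldMap f (xs ++ ys) ≈ foldMap f xs ∙ foldMap f ys
  foldMap-++ f []       ys = sym (identityˡ _)
  foldMap-++ f (x ∷ xs) ys = trans (∙-congˡ (foldMap-++ f xs ys)) (sym (assoc _ _ _))

  foldMap-ε : ∀ (f : A → Carrier) xs → (∀ x → f x ≈ ε) → foldMap f xs ≈ ε
  foldMap-ε f []       f≈ε = refl
  foldMap-ε f (x ∷ xs) f≈ε = trans (∙-cong (f≈ε x) (foldMap-ε f xs f≈ε)) (identityˡ ε)

  foldMap-∙ : ∀ (f g : A → Carrier) xs → foldMap (λ x → f x ∙ g x) xs ≈ foldMap f xs ∙ foldMap g xs
  foldMap-∙ f g []       = sym (identityˡ ε)
  foldMap-∙ f g (x ∷ xs) = trans (∙-congˡ (foldMap-∙ f g xs)) (interchange _ _ _ _)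

  foldMap-map : (f : B → Carrier) (g : A → B) (xs : List A) → foldMap f (map g xs) ≈ foldMap (f ∘ g) xs
  foldMap-map f g []       = refl
  foldMap-map f g (x ∷ xs) = ∙-congˡ (foldMap-map f g xs)

  foldMap-concatMap : (f : B → Carrier) (g : A → List B) (xs : List A) →
                      foldMap f (concatMap g xs) ≈ foldMap (λ x → foldMap f (g x)) xs
  foldMap-concatMap f g []       = refl
  foldMap-concatMap f g (x ∷ xs) = trans (foldMap-++ f (g x) (concatMap g xs)) (∙-congˡ (foldMap-concatMap f g xs))

  foldMap-comm : (f : A → B → Carrier) (xs : List A) (ys : List B) →
                 foldMap (λ x → foldMap (f x) ys) xs ≈ foldMap (λ y → foldMap (λ x → f x y) xs) ys
  foldMap-comm f []       ys = sym (foldMap-ε _ ys (λ _ → refl))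
  foldMap-comm f (x ∷ xs) ys = trans (∙-congˡ (foldMap-comm f xs ys)) (sym (foldMap-∙ (f x) _ ys))

  foldMap-applyUpTo : ∀ (f : A → Carrier) (g : ℕ → A) n → foldMap f (applyUpTo g n) ≈ foldMap (f ∘ g) (upTo n)
  foldMap-applyUpTo f g zero    = refl
  foldMap-applyUpTo f g (suc n) =
    ∙-congˡ (trans (foldMap-applyUpTo f (g ∘ suc) n) (sym (foldMap-applyUpTo (f ∘ g) suc n)))

  foldMap-tabulate : ∀ {n} (f : A → Carrier) (g : Fin n → A) → foldMap f (tabulate g) ≈ sum (f ∘ g)
  foldMap-tabulate {n = zero}  f g = refl
  foldMap-tabulate {n = suc n} f g = ∙-congˡ (foldMap-tabulate f (g ∘ suc))

  foldMap-allFin-permute : ∀ {n} (f : Fin n → Carrier) (π : Permutation′ n) →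
                           foldMap f (allFin n) ≈ foldMap (f ∘ (π ⟨$⟩ʳ_)) (allFin n)
  foldMap-allFin-permute f π = begin
    foldMap f (allFin _)                ≈⟨ foldMap-tabulate f id ⟩
    sum f                               ≈⟨ sum-permute f π ⟩
    sum (f ∘ (π ⟨$⟩ʳ_))                 ≈⟨ foldMap-tabulate (f ∘ (π ⟨$⟩ʳ_)) id ⟨
    foldMap (f ∘ (π ⟨$⟩ʳ_)) (allFin _)  ∎

module RingSums {c ℓ} (R : CommutativeRing c ℓ) where
  open CommutativeRing R hiding (zero)
  open import Algebra.Properties.Semiring.Mult semiring using (_×_)
  open import Relation.Binary.Reasoning.Setoid setoid

  open ListFold +-commutativeMonoid public using ()
    renaming ( foldMap to ∑; foldMap-cong to ∑-cong; foldMap-ε to ∑-zero; foldMap-∙ to ∑-+; foldMap-++ to ∑-++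
             ; foldMap-map to ∑-map; foldMap-concatMap to ∑-concatMap; foldMap-comm to ∑-comm
             ; foldMap-applyUpTo to ∑-applyUpTo)
  open ListFold *-commutativeMonoid public using ()
    renaming ( foldMap to ∏; foldMap-cong to ∏-cong; foldMap-∙ to ∏-*; foldMap-map to ∏-map
             ; foldMap-tabulate to ∏-tabulate)
  open FinSum *-commutativeMonoid public using ()
    renaming (sum to ∏ᵢ; sum-cong-≋ to ∏ᵢ-cong; ∑-distrib-+ to ∏ᵢ-*)

  ∑-distribˡ : ∀ k (f : A → Carrier) xs → k * ∑ f xs ≈ ∑ (λ x → k * f x) xs
  ∑-distribˡ k f []       = zeroʳ k
  ∑-distribˡ k f (x ∷ xs) = trans (distribˡ k _ _) (+-congˡ (∑-distribˡ k f xs))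

  ∑-distribʳ : ∀ k (f : A → Carrier) xs → ∑ f xs * k ≈ ∑ (λ x → f x * k) xs
  ∑-distribʳ k f xs = trans (*-comm _ k) (trans (∑-distribˡ k f xs) (∑-cong xs (λ x → *-comm k (f x))))

  ∑-const : ∀ k (xs : List A) → ∑ (λ _ → k) xs ≈ length xs × k
  ∑-const k []       = refl
  ∑-const k (x ∷ xs) = +-congˡ (∑-const k xs)

  module _ {p} {P : Pred A p} (P? : Decidable P) where

    ∑-filter : ∀ (f : A → Carrier) xs → (∀ x → ¬ P x → f x ≈ 0#) → ∑ f (filter P? xs) ≈ ∑ f xs
    ∑-filter f []       f≈0 = refl
    ∑-filter f (x ∷ xs) f≈0 with P? x
    ... | yes _  = +-congˡ (∑-filter f xs f≈0)
    ... | no ¬Px = trans (∑-filter f xs f≈0) (trans (sym (+-identityˡ _)) (+-congʳ (sym (f≈0 x ¬Px))))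

    ∑-indicator : ∀ (f : A → Carrier) xs → (∀ x → P x → f x ≈ 1#) → (∀ x → ¬ P x → f x ≈ 0#) →
                  ∑ f xs ≈ length (filter P? xs) × 1#
    ∑-indicator f []       f≈1 f≈0 = refl
    ∑-indicator f (x ∷ xs) f≈1 f≈0 with P? x
    ... | yes Px = +-cong (f≈1 x Px) (∑-indicator f xs f≈1 f≈0)
    ... | no ¬Px = trans (+-cong (f≈0 x ¬Px) (∑-indicator f xs f≈1 f≈0)) (+-identityˡ _)

  ∏ᵢ-zero : ∀ {n} (f : Fin n → Carrier) i → f i ≈ 0# → ∏ᵢ f ≈ 0#
  ∏ᵢ-zero f zero    fi≈0 = trans (*-congʳ fi≈0) (zeroˡ _)
  ∏ᵢ-zero f (suc i) fi≈0 = trans (*-congˡ (∏ᵢ-zero (f ∘ suc) i fi≈0)) (zeroʳ _)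

  ∏ᵢ-one : ∀ {n} (f : Fin n → Carrier) → (∀ i → f i ≈ 1#) → ∏ᵢ f ≈ 1#
  ∏ᵢ-one {zero}  f f≈1 = refl
  ∏ᵢ-one {suc n} f f≈1 = trans (*-cong (f≈1 zero) (∏ᵢ-one (f ∘ suc) (f≈1 ∘ suc))) (*-identityˡ 1#)

  ∑-vecsOver-∏ᵢ : ∀ (xs : List A) {n} (g : Fin n → A → Carrier) →
                  ∑ (λ v → ∏ᵢ (λ i → g i (lookup v i))) (vecsOver xs n) ≈ ∏ᵢ (λ i → ∑ (g i) xs)
  ∑-vecsOver-∏ᵢ xs {zero}  g = +-identityʳ 1#
  ∑-vecsOver-∏ᵢ {A = A} xs {suc n} g = begin
    ∑ term (concatMap (λ v → map (_∷ v) xs) (vecsOver xs n))  ≈⟨ ∑-concatMap term _ (vecsOver xs n) ⟩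
    ∑ (λ v → ∑ term (map (_∷ v) xs)) (vecsOver xs n)          ≈⟨ ∑-cong (vecsOver xs n) split ⟩
    ∑ (λ v → ∑ (g zero) xs * rest v) (vecsOver xs n)          ≈⟨ ∑-distribˡ _ rest (vecsOver xs n) ⟨
    ∑ (g zero) xs * ∑ rest (vecsOver xs n)                    ≈⟨ *-congˡ (∑-vecsOver-∏ᵢ xs (g ∘ suc)) ⟩
    ∑ (g zero) xs * ∏ᵢ (λ i → ∑ (g (suc i)) xs)               ∎
    where
    term : Vec A (suc n) → Carrier
    term v = ∏ᵢ (λ i → g i (lookup v i))
    rest : Vec A n → Carrier
    rest v = ∏ᵢ (λ i → g (suc i) (lookup v i))
    split : ∀ v → ∑ term (map (_∷ v) xs) ≈ ∑ (g zero) xs * rest v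
    split v = trans (∑-map term (_∷ v) xs) (sym (∑-distribʳ (rest v) (g zero) xs))

∣zipWith-+∣ₑ : ∀ {m} (α β : Vec ℕ m) → ∣ zipWith ℕ._+_ α β ∣ₑ ≡ ∣ α ∣ₑ ℕ.+ ∣ β ∣ₑ
∣zipWith-+∣ₑ []      []      = ≡.refl
∣zipWith-+∣ₑ (a ∷ α) (b ∷ β) = ≡.trans (≡.cong (a ℕ.+ b ℕ.+_) (∣zipWith-+∣ₑ α β))
  (CommutativeSemigroupProperties.interchange ℕ.+-commutativeSemigroup a b ∣ α ∣ₑ ∣ β ∣ₑ)

∣replicate-0∣ₑ : ∀ m → ∣ replicate m 0 ∣ₑ ≡ 0
∣replicate-0∣ₑ zero    = ≡.refl
∣replicate-0∣ₑ (suc m) = ∣replicate-0∣ₑ m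

∣∣ₑ<*⇒∃lookup< : ∀ K {m} (α : Vec ℕ m) → ∣ α ∣ₑ < m ℕ.* K → ∃ λ j → lookup α j < K
∣∣ₑ<*⇒∃lookup< K []      ()
∣∣ₑ<*⇒∃lookup< K (a ∷ α) ∣aα∣<[1+m]K with a ℕ.<? K
... | yes a<K = zero , a<K
... | no  a≮K with ∣∣ₑ<*⇒∃lookup< K α
  (ℕ.+-cancelˡ-< K _ _ (ℕ.≤-<-trans (ℕ.+-monoˡ-≤ ∣ α ∣ₑ (ℕ.≮⇒≥ a≮K)) ∣aα∣<[1+m]K))
... | j , αj<K = suc j , αj<K

weight-add : ∀ {d b b′ u u′ D D′} → d ℕ.* b ℕ.+ u ≤ D → d ℕ.* b′ ℕ.+ u′ ≤ D′ →
             d ℕ.* (b ℕ.+ b′) ℕ.+ (u ℕ.+ u′) ≤ D ℕ.+ D′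
weight-add {d} {b} {b′} {u} {u′} h h′ = ℕ.≤-trans (ℕ.≤-reflexive (regroup d b b′ u u′)) (ℕ.+-mono-≤ h h′)
  where
  regroup : ∀ d b b′ u u′ → d ℕ.* (b ℕ.+ b′) ℕ.+ (u ℕ.+ u′) ≡ (d ℕ.* b ℕ.+ u) ℕ.+ (d ℕ.* b′ ℕ.+ u′)
  regroup = ℕ-Solver.solve-∀

weight-mul : ∀ {d b a u D} → a ≤ d → d ℕ.* b ℕ.+ u ≤ D → d ℕ.* b ℕ.+ (a ℕ.+ u) ≤ d ℕ.+ D
weight-mul {d} {b} {a} {u} a≤d h = ℕ.≤-trans (ℕ.≤-reflexive (regroup d b a u)) (ℕ.+-mono-≤ a≤d h)
  where
  regroup : ∀ d b a u → d ℕ.* b ℕ.+ (a ℕ.+ u) ≡ a ℕ.+ (d ℕ.* b ℕ.+ u)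
  regroup = ℕ-Solver.solve-∀

weight-shift : ∀ {d b u D} → d ℕ.* b ℕ.+ u ≤ D → d ℕ.* suc b ℕ.+ u ≤ d ℕ.+ D
weight-shift {d} {b} {u} h = ℕ.≤-trans (ℕ.≤-reflexive (regroup d b u)) (ℕ.+-monoʳ-≤ d h)
  where
  regroup : ∀ d b u → d ℕ.* suc b ℕ.+ u ≡ d ℕ.+ (d ℕ.* b ℕ.+ u)
  regroup = ℕ-Solver.solve-∀

degree-gap : ∀ d K m n {w t} → K ℕ.* (n ℕ.* d) < w ℕ.+ K ℕ.* m → w ℕ.+ t ≤ n ℕ.* (d ℕ.* K) → t < m ℕ.* K
degree-gap d K m n {w} {t} gap w+t≤ndK = ≡.subst (t <_) (ℕ.*-comm K m) (ℕ.+-cancelˡ-< w t (K ℕ.* m)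
  (ℕ.≤-<-trans (ℕ.≤-trans w+t≤ndK (ℕ.≤-reflexive (reorder n d K))) gap))
  where
  reorder : ∀ n d K → n ℕ.* (d ℕ.* K) ≡ K ℕ.* (n ℕ.* d)
  reorder = ℕ-Solver.solve-∀

-- Finite fields

-- Stated with s = t - r as an atom: without a zero test on coefficients the ring solver cannot
-- cancel r - r.
module DivisionIdentities {c ℓ} (R : CommutativeRing c ℓ) where
  ring : AlmostCommutativeRing c ℓ
  ring = fromCommutativeRing R (λ _ → nothing)
  open AlmostCommutativeRing ring

  divide-base : ∀ a s r → a + (s + r) ≈ s + (a + r)
  divide-base = solve-∀ ring

  divide-step : ∀ a s r Q ρ → a + (s + r) * (s * Q + ρ) ≈ s * (ρ + (s + r) * Q) + (a + r * ρ)
  divide-step = solve-∀ ring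

module _ {c ℓ q} (F : FiniteField c ℓ q) where
  open FiniteField F hiding (zero)
  open RingSums commutativeRing
  open CommutativeSemigroupProperties *-commutativeSemigroup using ()
    renaming (interchange to *-interchange; x∙yz≈y∙xz to *-left-commutative)
  open CommutativeSemigroupProperties +-commutativeSemigroup using () renaming (interchange to +-interchange)
  open import Algebra.Properties.Semiring.Mult semiring using (_×_; ×1-homo-*)
  open import Algebra.Properties.AbelianGroup +-abelianGroup
    using (identityʳ-unique; //-rightDividesˡ; //-rightDividesʳ; x∙y⁻¹≈ε⇒x≈y; x≈y⇒x∙y⁻¹≈ε; ⁻¹-∙-comm)
  open import Algebra.Properties.Ring ring using (-‿distribˡ-*; -‿distribʳ-*; -0#≈0#)
  open import Relation.Binary.Reasoning.Setoid setoid

  infixr 8 _^_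
  _^_ : Carrier → ℕ → Carrier
  x ^ k = pow F x k

  ^-cong : ∀ {x y} k → x ≈ y → x ^ k ≈ y ^ k
  ^-cong zero    x≈y = refl
  ^-cong (suc k) x≈y = *-cong x≈y (^-cong k x≈y)

  ^-distribʳ-* : ∀ x y k → (x * y) ^ k ≈ x ^ k * y ^ k
  ^-distribʳ-* x y zero    = sym (*-identityˡ 1#)
  ^-distribʳ-* x y (suc k) = trans (*-congˡ (^-distribʳ-* x y k)) (*-interchange x y _ _)

  ^-+ : ∀ x a b → x ^ (a ℕ.+ b) ≈ x ^ a * x ^ b
  ^-+ x zero    b = sym (*-identityˡ _)
  ^-+ x (suc a) b = trans (*-congˡ (^-+ x a b)) (sym (*-assoc _ _ _))

  _⁻¹[_] : ∀ x → ¬ x ≈ 0# → Carrier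
  x ⁻¹[ x≉0 ] = proj₁ (inverse x x≉0)

  *-inverseʳ-cancel : ∀ {x} (x≉0 : ¬ x ≈ 0#) y → x * (x ⁻¹[ x≉0 ] * y) ≈ y
  *-inverseʳ-cancel x≉0 y = trans (sym (*-assoc _ _ _)) (trans (*-congʳ (proj₂ (inverse _ x≉0))) (*-identityˡ y))

  *-inverseˡ-cancel : ∀ {x} (x≉0 : ¬ x ≈ 0#) y → x ⁻¹[ x≉0 ] * (x * y) ≈ y
  *-inverseˡ-cancel x≉0 y =
    trans (sym (*-assoc _ _ _)) (trans (*-congʳ (trans (*-comm _ _) (proj₂ (inverse _ x≉0)))) (*-identityˡ y))

  *-cancelˡ-≉0 : ∀ {z x y} → ¬ z ≈ 0# → z * x ≈ z * y → x ≈ y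
  *-cancelˡ-≉0 {z} {x} {y} z≉0 zx≈zy = begin
    x                      ≈⟨ *-inverseˡ-cancel z≉0 x ⟨
    z ⁻¹[ z≉0 ] * (z * x)  ≈⟨ *-congˡ zx≈zy ⟩
    z ⁻¹[ z≉0 ] * (z * y)  ≈⟨ *-inverseˡ-cancel z≉0 y ⟩
    y                      ∎

  x≉0∧y≉0⇒x*y≉0 : ∀ {x y} → ¬ x ≈ 0# → ¬ y ≈ 0# → ¬ x * y ≈ 0#
  x≉0∧y≉0⇒x*y≉0 x≉0 y≉0 xy≈0 = y≉0 (*-cancelˡ-≉0 x≉0 (trans xy≈0 (sym (zeroʳ _))))

  elements : List Carrier
  elements = map elem (allFin q)

  length-elements : length elements ≡ q
  length-elements = ≡.trans (length-map elem (allFin q)) (length-tabulate id)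

  elements-distinct : AllPairs (λ x y → ¬ x ≈ y) elements
  elements-distinct = AllPairsP.map⁺ (AllPairs.map (λ i≢j elem-i≈j → i≢j (elem-injective _ _ elem-i≈j)) (allFin⁺ q))

  ∑-const-elements : ∀ k → ∑ (λ _ → k) elements ≈ q × k
  ∑-const-elements k = trans (∑-const k elements) (reflexive (≡.cong (_× k) length-elements))

  module Reindex (σ τ : Carrier → Carrier)
                 (σ-cong : ∀ {x y} → x ≈ y → σ x ≈ σ y) (τ-cong : ∀ {x y} → x ≈ y → τ x ≈ τ y)
                 (σ∘τ≈id : ∀ x → σ (τ x) ≈ x) (τ∘σ≈id : ∀ x → τ (σ x) ≈ x) where

    index : Carrier → Fin q
    index x = proj₁ (elem-surjective x)

    elem∘index : ∀ x → elem (index x) ≈ x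
    elem∘index x = proj₂ (elem-surjective x)

    σ-permutation : Permutation′ q
    σ-permutation = permutation (index ∘ σ ∘ elem) (index ∘ τ ∘ elem)
      (λ i → elem-injective _ _ (trans (elem∘index _) (trans (σ-cong (elem∘index _)) (σ∘τ≈id _))))
      (λ i → elem-injective _ _ (trans (elem∘index _) (trans (τ-cong (elem∘index _)) (τ∘σ≈id _))))

    foldMap-elements-reindex : ∀ {c′ ℓ′} (M : CommutativeMonoid c′ ℓ′) (f : Carrier → CommutativeMonoid.Carrier M) →
      (∀ {x y} → x ≈ y → CommutativeMonoid._≈_ M (f x) (f y)) →
      CommutativeMonoid._≈_ M (ListFold.foldMap M (f ∘ σ) elements) (ListFold.foldMap M f elements)
    foldMap-elements-reindex M f f-cong = M.begin
      foldMap (f ∘ σ) elements                         M.≈⟨ foldMap-map (f ∘ σ) elem (allFin q) ⟩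
      foldMap (f ∘ σ ∘ elem) (allFin q)                M.≈⟨ foldMap-cong (allFin q) (λ i → f-cong (sym (elem∘index _))) ⟩
      foldMap (f ∘ elem ∘ (σ-permutation ⟨$⟩ʳ_)) (allFin q) M.≈⟨ foldMap-allFin-permute (f ∘ elem) σ-permutation ⟨
      foldMap (f ∘ elem) (allFin q)                    M.≈⟨ foldMap-map f elem (allFin q) ⟨
      foldMap f elements                               M.∎
      where
      open ListFold M
      module M where
        open CommutativeMonoid M public using (_≈_)
        open import Relation.Binary.Reasoning.Setoid (CommutativeMonoid.setoid M) public

  module Scaling {a} (a≉0 : ¬ a ≈ 0#) =
    Reindex (a *_) (a ⁻¹[ a≉0 ] *_) *-congˡ *-congˡ (*-inverseʳ-cancel a≉0) (*-inverseˡ-cancel a≉0)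

  q×1≈0 : q × 1# ≈ 0#
  q×1≈0 = identityʳ-unique (∑ id elements) (q × 1#) (begin
    ∑ id elements + q × 1#                     ≈⟨ +-congˡ (∑-const-elements 1#) ⟨
    ∑ id elements + ∑ (λ _ → 1#) elements      ≈⟨ ∑-+ id (λ _ → 1#) elements ⟨
    ∑ (λ t → t + 1#) elements                  ≈⟨ ∑-shift ⟩
    ∑ id elements                              ∎)
    where
    ∑-shift : ∑ (λ t → t + 1#) elements ≈ ∑ id elements
    ∑-shift = Reindex.foldMap-elements-reindex (_+ 1#) (_- 1#) +-congʳ +-congʳ
      (//-rightDividesˡ 1#) (//-rightDividesʳ 1#) +-commutativeMonoid id id

  ∏-≉0 : ∀ (f : A → Carrier) xs → (∀ x → ¬ f x ≈ 0#) → ¬ ∏ f xs ≈ 0#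
  ∏-≉0 f []       f≉0 = 1≉0
  ∏-≉0 f (x ∷ xs) f≉0 = x≉0∧y≉0⇒x*y≉0 (f≉0 x) (∏-≉0 f xs f≉0)

  ∏ᵢ-const : ∀ {n} x (f : Fin n → Carrier) → (∀ j → f j ≈ x) → ∏ᵢ f ≈ x ^ n
  ∏ᵢ-const {zero}  x f f≈x = refl
  ∏ᵢ-const {suc n} x f f≈x = *-cong (f≈x zero) (∏ᵢ-const x (f ∘ suc) (f≈x ∘ suc))

  ∏ᵢ-const-except : ∀ {n} x (f : Fin n → Carrier) i → f i ≈ 1# → (∀ j → j ≢ i → f j ≈ x) → ∏ᵢ f ≈ x ^ (n ∸ 1)
  ∏ᵢ-const-except x f zero fi≈1 f≈x =
    trans (*-congʳ fi≈1) (trans (*-identityˡ _) (∏ᵢ-const x (f ∘ suc) (λ j → f≈x (suc j) λ ())))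
  ∏ᵢ-const-except {suc (suc n)} x f (suc i) fi≈1 f≈x =
    *-cong (f≈x zero λ ()) (∏ᵢ-const-except x (f ∘ suc) i fi≈1 (λ j j≢i → f≈x (suc j) (j≢i ∘ suc-injective)))

  -- Multiplication by x ≉ 0 permutes the elements, so ∏ unit (x * t) = ∏ unit t, where unit
  -- replaces 0 by 1; the left side is x ^ (q ∸ 1) · ∏ unit t as exactly one t is 0.
  fermat : ∀ {x} → ¬ x ≈ 0# → x ^ (q ∸ 1) ≈ 1#
  fermat {x} x≉0 = *-cancelˡ-≉0 (∏-≉0 unit elements unit-≉0) (begin
    ∏ unit elements * x ^ (q ∸ 1)         ≈⟨ *-comm _ _ ⟩
    x ^ (q ∸ 1) * ∏ unit elements         ≈⟨ *-congʳ ∏-factor ⟨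
    ∏ factor elements * ∏ unit elements   ≈⟨ ∏-* factor unit elements ⟨
    ∏ (λ t → factor t * unit t) elements  ≈⟨ ∏-cong elements factor*unit ⟩
    ∏ (λ t → unit (x * t)) elements       ≈⟨ Scaling.foldMap-elements-reindex x≉0 *-commutativeMonoid unit unit-cong ⟩
    ∏ unit elements                       ≈⟨ *-identityʳ _ ⟨
    ∏ unit elements * 1#                  ∎)
    where
    unit : Carrier → Carrier
    unit t with t ≟ 0#
    ... | yes _ = 1#
    ... | no  _ = t

    factor : Carrier → Carrier
    factor t with t ≟ 0#
    ... | yes _ = 1#
    ... | no  _ = x

    unit-≉0 : ∀ t → ¬ unit t ≈ 0#
    unit-≉0 t with t ≟ 0#
    ... | yes _   = 1≉0
    ... | no  t≉0 = t≉0

    unit-cong : ∀ {t u} → t ≈ u → unit t ≈ unit u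
    unit-cong {t} {u} t≈u with t ≟ 0# | u ≟ 0#
    ... | yes _   | yes _   = refl
    ... | yes t≈0 | no  u≉0 = contradiction (trans (sym t≈u) t≈0) u≉0
    ... | no  t≉0 | yes u≈0 = contradiction (trans t≈u u≈0) t≉0
    ... | no  _   | no  _   = t≈u

    factor*unit : ∀ t → factor t * unit t ≈ unit (x * t)
    factor*unit t with t ≟ 0# | (x * t) ≟ 0#
    ... | yes _   | yes _    = *-identityˡ 1#
    ... | yes t≈0 | no  xt≉0 = contradiction (trans (*-congˡ t≈0) (zeroʳ x)) xt≉0
    ... | no  t≉0 | yes xt≈0 = contradiction xt≈0 (x≉0∧y≉0⇒x*y≉0 x≉0 t≉0)
    ... | no  _   | no  _    = refl

    zero-index : Fin q
    zero-index = proj₁ (elem-surjective 0#)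

    ∏-factor : ∏ factor elements ≈ x ^ (q ∸ 1)
    ∏-factor = trans (∏-map factor elem (allFin q)) (trans (∏-tabulate (factor ∘ elem) id)
      (∏ᵢ-const-except x (factor ∘ elem) zero-index factor-zero factor-nonzero))
      where
      factor-zero : factor (elem zero-index) ≈ 1#
      factor-zero with elem zero-index ≟ 0#
      ... | yes _  = refl
      ... | no  ≉0 = contradiction (proj₂ (elem-surjective 0#)) ≉0
      factor-nonzero : ∀ j → j ≢ zero-index → factor (elem j) ≈ x
      factor-nonzero j j≢0 with elem j ≟ 0#
      ... | yes ≈0 = contradiction (elem-injective _ _ (trans ≈0 (sym (proj₂ (elem-surjective 0#))))) j≢0
      ... | no  _  = refl

  -- a₀ ∷ a₁ ∷ … ∷ a_{k-1} stands for the monic polynomial a₀ + a₁ t + ⋯ + a_{k-1} t^{k-1} + t^k.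
  evalMonic : ∀ {k} → Vec Carrier k → Carrier → Carrier
  evalMonic []       t = 1#
  evalMonic (a ∷ as) t = a + t * evalMonic as t

  monic-divide : ∀ {k} (p : Vec Carrier (suc k)) r →
                 ∃ λ (Q : Vec Carrier k) → ∃ λ ρ → ∀ t → evalMonic p t ≈ (t - r) * evalMonic Q t + ρ
  monic-divide (a ∷ []) r = [] , a + r , λ t → begin
    a + t * 1#                  ≈⟨ +-congˡ (trans (*-identityʳ t) (sym (//-rightDividesˡ r t))) ⟩
    a + ((t - r) + r)           ≈⟨ DivisionIdentities.divide-base commutativeRing a (t - r) r ⟩
    (t - r) + (a + r)           ≈⟨ +-congʳ (*-identityʳ _) ⟨
    (t - r) * 1# + (a + r)      ∎
  monic-divide (a ∷ p@(_ ∷ _)) r with monic-divide p r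
  ... | Q , ρ , p≈ = ρ ∷ Q , a + r * ρ , λ t → begin
    a + t * evalMonic p t                                ≈⟨ +-congˡ (*-cong (sym (//-rightDividesˡ r t)) (p≈ t)) ⟩
    a + ((t - r) + r) * ((t - r) * evalMonic Q t + ρ)    ≈⟨ DivisionIdentities.divide-step commutativeRing a (t - r) r _ ρ ⟩
    (t - r) * (ρ + ((t - r) + r) * evalMonic Q t) + (a + r * ρ)
                                                         ≈⟨ +-congʳ (*-congˡ (+-congˡ (*-congʳ (//-rightDividesˡ r t)))) ⟩
    (t - r) * (ρ + t * evalMonic Q t) + (a + r * ρ)      ∎

  monic-factor : ∀ {k} (p : Vec Carrier (suc k)) r → evalMonic p r ≈ 0# →
                 ∃ λ (Q : Vec Carrier k) → ∀ t → evalMonic p t ≈ (t - r) * evalMonic Q t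
  monic-factor p r pr≈0 with monic-divide p r
  ... | Q , ρ , p≈ = Q , λ t → trans (p≈ t) (trans (+-congˡ ρ≈0) (+-identityʳ _))
    where
    ρ≈0 : ρ ≈ 0#
    ρ≈0 = begin
      ρ                               ≈⟨ +-identityˡ ρ ⟨
      0# + ρ                          ≈⟨ +-congʳ (trans (*-congʳ (-‿inverseʳ r)) (zeroˡ _)) ⟨
      (r - r) * evalMonic Q r + ρ     ≈⟨ p≈ r ⟨
      evalMonic p r                   ≈⟨ pr≈0 ⟩
      0#                              ∎

  monic-root-bound : ∀ {k} (p : Vec Carrier k) (rs : List Carrier) → AllPairs (λ x y → ¬ x ≈ y) rs →
                     All (λ r → evalMonic p r ≈ 0#) rs → length rs ≤ k
  monic-root-bound p        []       _ _ = z≤n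
  monic-root-bound []       (r ∷ rs) _ (1≈0 ∷ _) = contradiction 1≈0 1≉0
  monic-root-bound p@(_ ∷ _) (r ∷ rs) (r≉rs ∷ distinct) (pr≈0 ∷ prs≈0) with monic-factor p r pr≈0
  ... | Q , p≈[t-r]Q =
    s≤s (monic-root-bound Q rs distinct (All.zipWith (λ (r≉s , ps≈0) → Q-root r≉s ps≈0) (r≉rs , prs≈0)))
    where
    Q-root : ∀ {s} → ¬ r ≈ s → evalMonic p s ≈ 0# → evalMonic Q s ≈ 0#
    Q-root {s} r≉s ps≈0 = *-cancelˡ-≉0 s-r≉0 (begin
      (s - r) * evalMonic Q s  ≈⟨ p≈[t-r]Q s ⟨
      evalMonic p s            ≈⟨ ps≈0 ⟩
      0#                       ≈⟨ zeroʳ _ ⟨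
      (s - r) * 0#             ∎)
      where
      s-r≉0 : ¬ s - r ≈ 0#
      s-r≉0 s-r≈0 = r≉s (sym (x∙y⁻¹≈ε⇒x≈y s r s-r≈0))

  evalMonic-zeros : ∀ k t → evalMonic (replicate k 0#) t ≈ t ^ k
  evalMonic-zeros zero    t = refl
  evalMonic-zeros (suc k) t = trans (+-identityˡ _) (*-congˡ (evalMonic-zeros k t))

  -- Otherwise every element would be a root of the monic polynomial t^(k+2) - t of degree k + 2 < q.
  ∃-pow≉self : ∀ k → suc k < q ∸ 1 → ∃ λ c → ¬ c ^ suc (suc k) ≈ c
  ∃-pow≉self k k+1<q-1 with any? (λ i → ¬? ((elem i ^ suc (suc k)) ≟ elem i))
  ... | yes (i , c^[k+2]≉c) = elem i , c^[k+2]≉c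
  ... | no  none            = contradiction (∸-monoˡ-≤ 1 q≤k+2) (<⇒≱ k+1<q-1)
    where
    t^[k+2]-t : Vec Carrier (suc (suc k))
    t^[k+2]-t = 0# ∷ - 1# ∷ replicate k 0#

    root : ∀ i → evalMonic t^[k+2]-t (elem i) ≈ 0#
    root i = begin
      0# + t * (- 1# + t * evalMonic (replicate k 0#) t)  ≈⟨ +-identityˡ _ ⟩
      t * (- 1# + t * evalMonic (replicate k 0#) t)       ≈⟨ *-congˡ (+-congˡ (*-congˡ (evalMonic-zeros k t))) ⟩
      t * (- 1# + t ^ suc k)                              ≈⟨ distribˡ t _ _ ⟩
      t * - 1# + t ^ suc (suc k)                          ≈⟨ +-cong (trans (sym (-‿distribʳ-* t 1#)) (-‿cong (*-identityʳ t)))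
                                                                    t^[k+2]≈t ⟩
      - t + t                                             ≈⟨ -‿inverseˡ t ⟩
      0#                                                  ∎
      where
      t : Carrier
      t = elem i
      t^[k+2]≈t : t ^ suc (suc k) ≈ t
      t^[k+2]≈t = decidable-stable ((t ^ suc (suc k)) ≟ t) (λ ≉ → none (i , ≉))

    q≤k+2 : q ≤ suc (suc k)
    q≤k+2 = ≡.subst (_≤ suc (suc k)) length-elements
      (monic-root-bound t^[k+2]-t elements elements-distinct (AllP.map⁺ (AllP.tabulate⁺ root)))

  ^-zeroˡ : ∀ {x} n → x ≈ 0# → x ^ suc n ≈ 0#
  ^-zeroˡ n x≈0 = trans (*-congʳ x≈0) (zeroˡ _)

  -- Scaling by an element c with c^(k+1) ≉ 1 multiplies the sum by c^(k+1) and leaves it unchanged.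
  ∑-pow≈0 : ∀ k → k < q ∸ 1 → ∑ (_^ k) elements ≈ 0#
  ∑-pow≈0 zero    _ = trans (∑-const-elements 1#) q×1≈0
  ∑-pow≈0 (suc k) k+1<q-1 with ∃-pow≉self k k+1<q-1 | ∑ (_^ suc k) elements ≟ 0#
  ... | _                 | yes S≈0 = S≈0
  ... | c , c^[k+2]≉c     | no  S≉0 = contradiction (*-cancelˡ-≉0 S≉0 (begin
    S * c ^ suc k                             ≈⟨ *-comm _ _ ⟩
    c ^ suc k * S                             ≈⟨ ∑-distribˡ _ (_^ suc k) elements ⟩
    ∑ (λ t → c ^ suc k * t ^ suc k) elements  ≈⟨ ∑-cong elements (λ t → ^-distribʳ-* c t (suc k)) ⟨
    ∑ (λ t → (c * t) ^ suc k) elements        ≈⟨ Scaling.foldMap-elements-reindex c≉0 +-commutativeMonoid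
                                                   (_^ suc k) (^-cong (suc k)) ⟩
    S                                         ≈⟨ *-identityʳ S ⟨
    S * 1#                                    ∎)) c^[k+1]≉1
    where
    S : Carrier
    S = ∑ (_^ suc k) elements
    c≉0 : ¬ c ≈ 0#
    c≉0 c≈0 = c^[k+2]≉c (trans (^-zeroˡ (suc k) c≈0) (sym c≈0))
    c^[k+1]≉1 : ¬ c ^ suc k ≈ 1#
    c^[k+1]≉1 c^[k+1]≈1 = c^[k+2]≉c (trans (*-congˡ c^[k+1]≈1) (*-identityʳ c))

  1<q : 1 < q
  1<q = at-least-two elem elem-surjective
    where
    at-least-two : ∀ {n} (e : Fin n → Carrier) → (∀ x → ∃ λ i → e i ≈ x) → 1 < n
    at-least-two {zero}        e surjective with surjective 0#
    ... | () , _
    at-least-two {suc zero}    e surjective with surjective 0# | surjective 1#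
    ... | zero , e0≈0 | zero , e0≈1 = contradiction (trans (sym e0≈1) e0≈0) 1≉0
    at-least-two {suc (suc n)} e surjective = s≤s (s≤s z≤n)

  indicator : Carrier → Carrier
  indicator z = 1# - z ^ (q ∸ 1)

  indicator-≈0 : ∀ {z} → z ≈ 0# → indicator z ≈ 1#
  indicator-≈0 {z} z≈0 with q ∸ 1 | m<n⇒0<n∸m 1<q
  ... | suc k | _ = trans (+-congˡ (trans (-‿cong (^-zeroˡ k z≈0)) -0#≈0#)) (+-identityʳ 1#)

  indicator-≉0 : ∀ {z} → ¬ z ≈ 0# → indicator z ≈ 0#
  indicator-≉0 z≉0 = trans (+-congˡ (-‿cong (fermat z≉0))) (-‿inverseʳ 1#)

  [1+u]×1≉0 : ∀ u → u × 1# ≈ 0# → ¬ suc u × 1# ≈ 0#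
  [1+u]×1≉0 u u×1≈0 1+u×1≈0 = 1≉0 (trans (sym (trans (+-congˡ u×1≈0) (+-identityʳ 1#))) 1+u×1≈0)

  multiple-×1≈0 : ∀ a b → b × 1# ≈ 0# → (a ℕ.* b) × 1# ≈ 0#
  multiple-×1≈0 a b b×1≈0 = trans (×1-homo-* a _) (trans (*-congˡ b×1≈0) (zeroʳ _))

  coprime⇒×1≉0 : ∀ {k} → Coprime k q → ¬ k × 1# ≈ 0#
  coprime⇒×1≉0 {k} coprime k×1≈0 with coprime-Bézout coprime
  ... | Bézout.+- x y 1+yq≡xk = [1+u]×1≉0 (y ℕ.* q) (multiple-×1≈0 y q q×1≈0)
    (≡.subst (λ v → v × 1# ≈ 0#) (≡.sym 1+yq≡xk) (multiple-×1≈0 x k k×1≈0))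
  ... | Bézout.-+ x y 1+xk≡yq = [1+u]×1≉0 (x ℕ.* k) (multiple-×1≈0 x k k×1≈0)
    (≡.subst (λ v → v × 1# ≈ 0#) (≡.sym 1+xk≡yq) (multiple-×1≈0 y q q×1≈0))

  monomial-zipWith-+ : ∀ {m} (α β : Vec ℕ m) x → monomial F (zipWith ℕ._+_ α β) x ≈ monomial F α x * monomial F β x
  monomial-zipWith-+ []      []      []      = sym (*-identityˡ 1#)
  monomial-zipWith-+ (a ∷ α) (b ∷ β) (t ∷ x) =
    trans (*-cong (^-+ t a b) (monomial-zipWith-+ α β x)) (*-interchange _ _ _ _)

  monomial-replicate-0 : ∀ {m} (x : Vec Carrier m) → monomial F (replicate m 0) x ≈ 1#
  monomial-replicate-0 []      = refl
  monomial-replicate-0 (t ∷ x) = trans (*-identityˡ _) (monomial-replicate-0 x)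

  monomial≈∏ᵢ : ∀ {m} (α : Vec ℕ m) x → monomial F α x ≈ ∏ᵢ (λ j → lookup x j ^ lookup α j)
  monomial≈∏ᵢ []      []      = refl
  monomial≈∏ᵢ (a ∷ α) (t ∷ x) = *-congˡ (monomial≈∏ᵢ α x)

  -- The sum over F^m factors into one-variable power sums, one of which has exponent below q - 1.
  ∑-monomial≈0 : ∀ {m} (α : Vec ℕ m) → ∣ α ∣ₑ < m ℕ.* (q ∸ 1) → ∑ (monomial F α) (points F m) ≈ 0#
  ∑-monomial≈0 {m} α ∣α∣<m[q-1] = begin
    ∑ (monomial F α) (points F m)                                ≈⟨ ∑-cong (points F m) (monomial≈∏ᵢ α) ⟩
    ∑ (λ x → ∏ᵢ (λ j → lookup x j ^ lookup α j)) (points F m)    ≈⟨ ∑-vecsOver-∏ᵢ elements (λ j t → t ^ lookup α j) ⟩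
    ∏ᵢ (λ j → ∑ (_^ lookup α j) elements)                        ≈⟨ ∏ᵢ-zero _ j (∑-pow≈0 (lookup α j) αj<q-1) ⟩
    0#                                                           ∎
    where
    j : Fin m
    j = proj₁ (∣∣ₑ<*⇒∃lookup< (q ∸ 1) α ∣α∣<m[q-1])
    αj<q-1 : lookup α j < q ∸ 1
    αj<q-1 = proj₂ (∣∣ₑ<*⇒∃lookup< (q ∸ 1) α ∣α∣<m[q-1])

  -- Polynomials as lists of terms

  -- A polynomial in x₁ … x_m is represented by a list of terms a ·x^ α; exponents may repeat.
  record Term (m : ℕ) : Set c where
    constructor _·x^_
    field
      coefficient : Carrier
      exponent    : Vec ℕ m

  Terms : ℕ → Set c
  Terms m = List (Term m)

  ⟦_⟧ₜ : ∀ {m} → Term m → Vec Carrier m → Carrier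
  ⟦ a ·x^ α ⟧ₜ x = a * monomial F α x

  ⟦_⟧ : ∀ {m} → Terms m → Vec Carrier m → Carrier
  ⟦ ts ⟧ x = ∑ (λ t → ⟦ t ⟧ₜ x) ts

  degree : ∀ {m} → Term m → ℕ
  degree (_ ·x^ α) = ∣ α ∣ₑ

  𝟙 : ∀ {m} → Terms m
  𝟙 {m} = (1# ·x^ replicate m 0) ∷ []

  ⊖_ : ∀ {m} → Terms m → Terms m
  ⊖_ = map λ (a ·x^ α) → (- a) ·x^ α

  _⊗_ : ∀ {m} → Term m → Term m → Term m
  (a ·x^ α) ⊗ (b ·x^ β) = (a * b) ·x^ zipWith ℕ._+_ α β

  _⊛_ : ∀ {m} → Terms m → Terms m → Terms m
  ts ⊛ us = concatMap (λ t → map (t ⊗_) us) ts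

  ⟦𝟙⟧ : ∀ {m} (x : Vec Carrier m) → ⟦ 𝟙 ⟧ x ≈ 1#
  ⟦𝟙⟧ x = trans (+-identityʳ _) (trans (*-identityˡ _) (monomial-replicate-0 x))

  ⟦⊖⟧ : ∀ {m} (ts : Terms m) x → ⟦ ⊖ ts ⟧ x ≈ - ⟦ ts ⟧ x
  ⟦⊖⟧ []               x = sym -0#≈0#
  ⟦⊖⟧ ((a ·x^ α) ∷ ts) x = trans (+-cong (sym (-‿distribˡ-* a _)) (⟦⊖⟧ ts x)) (⁻¹-∙-comm _ _)

  ⟦⊛⟧ : ∀ {m} (ts us : Terms m) x → ⟦ ts ⊛ us ⟧ x ≈ ⟦ ts ⟧ x * ⟦ us ⟧ x
  ⟦⊛⟧ ts us x = begin
    ∑ (λ t → ⟦ t ⟧ₜ x) (ts ⊛ us)                              ≈⟨ ∑-concatMap _ _ ts ⟩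
    ∑ (λ t → ∑ (λ u → ⟦ u ⟧ₜ x) (map (t ⊗_) us)) ts           ≈⟨ ∑-cong ts (λ t → ∑-map _ (t ⊗_) us) ⟩
    ∑ (λ t → ∑ (λ u → ⟦ t ⊗ u ⟧ₜ x) us) ts                    ≈⟨ ∑-cong ts (λ t → ∑-cong us (⟦⊗⟧ t)) ⟩
    ∑ (λ t → ∑ (λ u → ⟦ t ⟧ₜ x * ⟦ u ⟧ₜ x) us) ts             ≈⟨ ∑-cong ts (λ t → ∑-distribˡ _ _ us) ⟨
    ∑ (λ t → ⟦ t ⟧ₜ x * ⟦ us ⟧ x) ts                          ≈⟨ ∑-distribʳ _ _ ts ⟨
    ⟦ ts ⟧ x * ⟦ us ⟧ x                                       ∎
    where
    ⟦⊗⟧ : ∀ t u → ⟦ t ⊗ u ⟧ₜ x ≈ ⟦ t ⟧ₜ x * ⟦ u ⟧ₜ x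
    ⟦⊗⟧ (a ·x^ α) (b ·x^ β) = trans (*-congˡ (monomial-zipWith-+ α β x)) (*-interchange _ _ _ _)

  degree-𝟙 : ∀ {m} → All (λ t → degree t ≡ 0) (𝟙 {m})
  degree-𝟙 {m} = ∣replicate-0∣ₑ m ∷ []

  degree-⊖ : ∀ {m p} {P : Pred ℕ p} (ts : Terms m) → All (P ∘ degree) ts → All (P ∘ degree) (⊖ ts)
  degree-⊖ []                []         = []
  degree-⊖ {P = P} ((a ·x^ α) ∷ ts) (Pt ∷ Pts) = Pt ∷ degree-⊖ {P = P} ts Pts

  degree-⊛ : ∀ {m p₁ p₂ p₃} {P : Pred ℕ p₁} {Q : Pred ℕ p₂} {R : Pred ℕ p₃} (ts us : Terms m) →
             (∀ {a b} → P a → Q b → R (a ℕ.+ b)) →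
             All (P ∘ degree) ts → All (Q ∘ degree) us → All (R ∘ degree) (ts ⊛ us)
  degree-⊛ []       us PQ⇒R []         Qus = []
  degree-⊛ {P = P} {Q} {R} (t@(a ·x^ α) ∷ ts) us PQ⇒R (Pα ∷ Pts) Qus =
    AllP.++⁺ (degree-t⊗ us Qus) (degree-⊛ {P = P} {Q} {R} ts us PQ⇒R Pts Qus)
    where
    degree-t⊗ : ∀ us → All (Q ∘ degree) us → All (R ∘ degree) (map (t ⊗_) us)
    degree-t⊗ []                []         = []
    degree-t⊗ ((b ·x^ β) ∷ us) (Qβ ∷ Qus) = ≡.subst R (≡.sym (∣zipWith-+∣ₑ α β)) (PQ⇒R Pα Qβ) ∷ degree-t⊗ us Qus

  ∑-⟦⟧≈0 : ∀ {m} (ts : Terms m) → All (λ t → degree t < m ℕ.* (q ∸ 1)) ts → ∑ ⟦ ts ⟧ (points F m) ≈ 0#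
  ∑-⟦⟧≈0 {m} []               []                = ∑-zero _ (points F m) (λ _ → refl)
  ∑-⟦⟧≈0 {m} ((a ·x^ α) ∷ ts) (α-small ∷ ts-small) = begin
    ∑ (λ x → a * monomial F α x + ⟦ ts ⟧ x) (points F m)                ≈⟨ ∑-+ _ ⟦ ts ⟧ (points F m) ⟩
    ∑ (λ x → a * monomial F α x) (points F m) + ∑ ⟦ ts ⟧ (points F m)  ≈⟨ +-cong ∑-aα≈0 (∑-⟦⟧≈0 ts ts-small) ⟩
    0# + 0#                                                           ≈⟨ +-identityˡ 0# ⟩
    0#                                                                ∎
    where
    ∑-aα≈0 : ∑ (λ x → a * monomial F α x) (points F m) ≈ 0#
    ∑-aα≈0 = trans (sym (∑-distribˡ a _ (points F m))) (trans (*-congˡ (∑-monomial≈0 α α-small)) (zeroʳ a))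

  -- E₀ ∷ E₁ ∷ ⋯ stands for E₀(x) + E₁(x) y + E₂(x) y² + ⋯, a polynomial in one further variable y.
  YPoly : ℕ → Set c
  YPoly m = List (Terms m)

  coeffAt : ∀ {m} → YPoly m → ℕ → Terms m
  coeffAt []      b       = []
  coeffAt (E ∷ L) zero    = E
  coeffAt (E ∷ L) (suc b) = coeffAt L b

  ⟦_⟧ʸ : ∀ {m} → YPoly m → Vec Carrier m → Carrier → Carrier
  ⟦ []    ⟧ʸ x y = 0#
  ⟦ E ∷ L ⟧ʸ x y = ⟦ E ⟧ x + y * ⟦ L ⟧ʸ x y

  _⊕_ : ∀ {m} → YPoly m → YPoly m → YPoly m
  []      ⊕ L′       = L′
  (E ∷ L) ⊕ []       = E ∷ L
  (E ∷ L) ⊕ (E′ ∷ L′) = (E ++ E′) ∷ (L ⊕ L′)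

  mulYMinus : ∀ {m} → Terms m → YPoly m → YPoly m
  mulYMinus φ L = map ((⊖ φ) ⊛_) L ⊕ ([] ∷ L)

  yMinusPow : ∀ {m} → Terms m → ℕ → YPoly m
  yMinusPow φ zero    = 𝟙 ∷ []
  yMinusPow φ (suc k) = mulYMinus φ (yMinusPow φ k)

  indicatorYPoly : ∀ {m} → Terms m → YPoly m
  indicatorYPoly φ = (𝟙 ∷ []) ⊕ map ⊖_ (yMinusPow φ (q ∸ 1))

  ⟦⊕⟧ʸ : ∀ {m} (L L′ : YPoly m) x y → ⟦ L ⊕ L′ ⟧ʸ x y ≈ ⟦ L ⟧ʸ x y + ⟦ L′ ⟧ʸ x y
  ⟦⊕⟧ʸ []      L′        x y = sym (+-identityˡ _)
  ⟦⊕⟧ʸ (E ∷ L) []        x y = sym (+-identityʳ _)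
  ⟦⊕⟧ʸ (E ∷ L) (E′ ∷ L′) x y = begin
    ⟦ E ++ E′ ⟧ x + y * ⟦ L ⊕ L′ ⟧ʸ x y                         ≈⟨ +-cong (∑-++ _ E E′) (*-congˡ (⟦⊕⟧ʸ L L′ x y)) ⟩
    (⟦ E ⟧ x + ⟦ E′ ⟧ x) + y * (⟦ L ⟧ʸ x y + ⟦ L′ ⟧ʸ x y)     ≈⟨ +-congˡ (distribˡ y _ _) ⟩
    (⟦ E ⟧ x + ⟦ E′ ⟧ x) + (y * ⟦ L ⟧ʸ x y + y * ⟦ L′ ⟧ʸ x y) ≈⟨ +-interchange _ _ _ _ ⟩
    (⟦ E ⟧ x + y * ⟦ L ⟧ʸ x y) + (⟦ E′ ⟧ x + y * ⟦ L′ ⟧ʸ x y) ∎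

  ⟦map-⊛⟧ʸ : ∀ {m} (N : Terms m) L x y → ⟦ map (N ⊛_) L ⟧ʸ x y ≈ ⟦ N ⟧ x * ⟦ L ⟧ʸ x y
  ⟦map-⊛⟧ʸ N []      x y = sym (zeroʳ _)
  ⟦map-⊛⟧ʸ N (E ∷ L) x y = begin
    ⟦ N ⊛ E ⟧ x + y * ⟦ map (N ⊛_) L ⟧ʸ x y         ≈⟨ +-cong (⟦⊛⟧ N E x) (*-congˡ (⟦map-⊛⟧ʸ N L x y)) ⟩
    ⟦ N ⟧ x * ⟦ E ⟧ x + y * (⟦ N ⟧ x * ⟦ L ⟧ʸ x y)  ≈⟨ +-congˡ (*-left-commutative y _ _) ⟩
    ⟦ N ⟧ x * ⟦ E ⟧ x + ⟦ N ⟧ x * (y * ⟦ L ⟧ʸ x y)  ≈⟨ distribˡ _ _ _ ⟨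
    ⟦ N ⟧ x * (⟦ E ⟧ x + y * ⟦ L ⟧ʸ x y)            ∎

  ⟦map-⊖⟧ʸ : ∀ {m} (L : YPoly m) x y → ⟦ map ⊖_ L ⟧ʸ x y ≈ - ⟦ L ⟧ʸ x y
  ⟦map-⊖⟧ʸ []      x y = sym -0#≈0#
  ⟦map-⊖⟧ʸ (E ∷ L) x y = begin
    ⟦ ⊖ E ⟧ x + y * ⟦ map ⊖_ L ⟧ʸ x y  ≈⟨ +-cong (⟦⊖⟧ E x) (*-congˡ (⟦map-⊖⟧ʸ L x y)) ⟩
    - ⟦ E ⟧ x + y * - ⟦ L ⟧ʸ x y      ≈⟨ +-congˡ (-‿distribʳ-* y _) ⟨
    - ⟦ E ⟧ x + - (y * ⟦ L ⟧ʸ x y)    ≈⟨ ⁻¹-∙-comm _ _ ⟩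
    - (⟦ E ⟧ x + y * ⟦ L ⟧ʸ x y)      ∎

  ⟦mulYMinus⟧ʸ : ∀ {m} φ (L : YPoly m) x y → ⟦ mulYMinus φ L ⟧ʸ x y ≈ (y - ⟦ φ ⟧ x) * ⟦ L ⟧ʸ x y
  ⟦mulYMinus⟧ʸ φ L x y = begin
    ⟦ map ((⊖ φ) ⊛_) L ⊕ ([] ∷ L) ⟧ʸ x y             ≈⟨ ⟦⊕⟧ʸ (map ((⊖ φ) ⊛_) L) ([] ∷ L) x y ⟩
    ⟦ map ((⊖ φ) ⊛_) L ⟧ʸ x y + (0# + y * ⟦ L ⟧ʸ x y) ≈⟨ +-cong (⟦map-⊛⟧ʸ (⊖ φ) L x y) (+-identityˡ _) ⟩
    ⟦ ⊖ φ ⟧ x * ⟦ L ⟧ʸ x y + y * ⟦ L ⟧ʸ x y          ≈⟨ +-congʳ (*-congʳ (⟦⊖⟧ φ x)) ⟩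
    - ⟦ φ ⟧ x * ⟦ L ⟧ʸ x y + y * ⟦ L ⟧ʸ x y          ≈⟨ +-comm _ _ ⟩
    y * ⟦ L ⟧ʸ x y + - ⟦ φ ⟧ x * ⟦ L ⟧ʸ x y          ≈⟨ distribʳ _ _ _ ⟨
    (y - ⟦ φ ⟧ x) * ⟦ L ⟧ʸ x y                       ∎

  ⟦yMinusPow⟧ʸ : ∀ {m} φ k (x : Vec Carrier m) y → ⟦ yMinusPow φ k ⟧ʸ x y ≈ (y - ⟦ φ ⟧ x) ^ k
  ⟦yMinusPow⟧ʸ φ zero    x y = trans (+-cong (⟦𝟙⟧ x) (zeroʳ y)) (+-identityʳ 1#)
  ⟦yMinusPow⟧ʸ φ (suc k) x y = trans (⟦mulYMinus⟧ʸ φ (yMinusPow φ k) x y) (*-congˡ (⟦yMinusPow⟧ʸ φ k x y))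

  ⟦indicatorYPoly⟧ʸ : ∀ {m} φ (x : Vec Carrier m) y → ⟦ indicatorYPoly φ ⟧ʸ x y ≈ indicator (y - ⟦ φ ⟧ x)
  ⟦indicatorYPoly⟧ʸ φ x y = begin
    ⟦ (𝟙 ∷ []) ⊕ map ⊖_ (yMinusPow φ (q ∸ 1)) ⟧ʸ x y           ≈⟨ ⟦⊕⟧ʸ (𝟙 ∷ []) (map ⊖_ (yMinusPow φ (q ∸ 1))) x y ⟩
    ⟦ 𝟙 ∷ [] ⟧ʸ x y + ⟦ map ⊖_ (yMinusPow φ (q ∸ 1)) ⟧ʸ x y    ≈⟨ +-cong (⟦yMinusPow⟧ʸ φ zero x y)
                                                                         (⟦map-⊖⟧ʸ (yMinusPow φ (q ∸ 1)) x y) ⟩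
    1# - ⟦ yMinusPow φ (q ∸ 1) ⟧ʸ x y                          ≈⟨ +-congˡ (-‿cong (⟦yMinusPow⟧ʸ φ (q ∸ 1) x y)) ⟩
    1# - (y - ⟦ φ ⟧ x) ^ (q ∸ 1)                               ∎

  length-⊕ : ∀ {m k} (L L′ : YPoly m) → length L ≤ k → length L′ ≤ k → length (L ⊕ L′) ≤ k
  length-⊕ []      L′        _        ∣L′∣≤k    = ∣L′∣≤k
  length-⊕ (E ∷ L) []        ∣L∣≤k    _         = ∣L∣≤k
  length-⊕ (E ∷ L) (E′ ∷ L′) (s≤s ∣L∣≤k) (s≤s ∣L′∣≤k) = s≤s (length-⊕ L L′ ∣L∣≤k ∣L′∣≤k)

  length-yMinusPow : ∀ {m} (φ : Terms m) k → length (yMinusPow φ k) ≤ suc k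
  length-yMinusPow φ zero    = ℕ.≤-refl
  length-yMinusPow φ (suc k) = length-⊕ (map ((⊖ φ) ⊛_) L) ([] ∷ L)
    (ℕ.≤-trans (ℕ.≤-reflexive (length-map _ L)) (ℕ.m≤n⇒m≤1+n (length-yMinusPow φ k))) (s≤s (length-yMinusPow φ k))
    where
    L : YPoly _
    L = yMinusPow φ k

  length-indicatorYPoly : ∀ {m} (φ : Terms m) → length (indicatorYPoly φ) ≤ suc (q ∸ 1)
  length-indicatorYPoly φ = length-⊕ (𝟙 ∷ []) (map ⊖_ (yMinusPow φ (q ∸ 1))) (s≤s z≤n)
    (ℕ.≤-trans (ℕ.≤-reflexive (length-map ⊖_ (yMinusPow φ (q ∸ 1)))) (length-yMinusPow φ (q ∸ 1)))

  coeffAt-length : ∀ {m} (L : YPoly m) b → length L ≤ b → coeffAt L b ≡ []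
  coeffAt-length []      b       _          = ≡.refl
  coeffAt-length (E ∷ L) (suc b) (s≤s ∣L∣≤b) = coeffAt-length L b ∣L∣≤b

  coeffAt-⊕ : ∀ {m p} {P : Pred (Term m) p} (L L′ : YPoly m) b →
              All P (coeffAt L b) → All P (coeffAt L′ b) → All P (coeffAt (L ⊕ L′) b)
  coeffAt-⊕ []      L′        b       _   PL′ = PL′
  coeffAt-⊕ (E ∷ L) []        b       PL  _   = PL
  coeffAt-⊕ (E ∷ L) (E′ ∷ L′) zero    PE  PE′ = AllP.++⁺ PE PE′
  coeffAt-⊕ (E ∷ L) (E′ ∷ L′) (suc b) PL  PL′ = coeffAt-⊕ L L′ b PL PL′

  coeffAt-map : ∀ {m} (f : Terms m → Terms m) → f [] ≡ [] → ∀ L b → coeffAt (map f L) b ≡ f (coeffAt L b)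
  coeffAt-map f f[]≡[] []      b       = ≡.sym f[]≡[]
  coeffAt-map f f[]≡[] (E ∷ L) zero    = ≡.refl
  coeffAt-map f f[]≡[] (E ∷ L) (suc b) = coeffAt-map f f[]≡[] L b

  ⊛-[] : ∀ {m} (ts : Terms m) → ts ⊛ [] ≡ []
  ⊛-[] []       = ≡.refl
  ⊛-[] (t ∷ ts) = ⊛-[] ts

  -- Giving y the weight d: every term of the coefficient of y^b has degree at most D - d b.
  WeightedDegreeAtMost : ∀ {m} → ℕ → ℕ → YPoly m → Set c
  WeightedDegreeAtMost d D L = ∀ b → All (λ t → d ℕ.* b ℕ.+ degree t ≤ D) (coeffAt L b)

  weighted-𝟙 : ∀ {m} d D → WeightedDegreeAtMost {m} d D (𝟙 ∷ [])
  weighted-𝟙 d D zero    =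
    All.map (λ ∣0∣≡0 → ℕ.≤-trans (ℕ.≤-reflexive (≡.cong₂ ℕ._+_ (ℕ.*-zeroʳ d) ∣0∣≡0)) z≤n) degree-𝟙
  weighted-𝟙 d D (suc b) = []

  weighted-mulYMinus : ∀ {m d D} {φ : Terms m} {L} → All (λ t → degree t ≤ d) φ →
                       WeightedDegreeAtMost d D L → WeightedDegreeAtMost d (d ℕ.+ D) (mulYMinus φ L)
  weighted-mulYMinus {d = d} {D} {φ} {L} φ≤d L≤D b = coeffAt-⊕ (map ((⊖ φ) ⊛_) L) ([] ∷ L) b
    (≡.subst (All _) (≡.sym (coeffAt-map ((⊖ φ) ⊛_) (⊛-[] (⊖ φ)) L b))
      (degree-⊛ {P = _≤ d} {Q = λ u → d ℕ.* b ℕ.+ u ≤ D} {R = λ u → d ℕ.* b ℕ.+ u ≤ d ℕ.+ D}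
        (⊖ φ) (coeffAt L b) weight-mul (degree-⊖ {P = _≤ d} φ φ≤d) (L≤D b)))
    (shifted b)
    where
    shifted : ∀ b → All (λ t → d ℕ.* b ℕ.+ degree t ≤ d ℕ.+ D) (coeffAt ([] ∷ L) b)
    shifted zero    = []
    shifted (suc b) = All.map weight-shift (L≤D b)

  weighted-yMinusPow : ∀ {m d} {φ : Terms m} → All (λ t → degree t ≤ d) φ →
                       ∀ k → WeightedDegreeAtMost d (d ℕ.* k) (yMinusPow φ k)
  weighted-yMinusPow {d = d} φ≤d zero    = weighted-𝟙 d (d ℕ.* 0)
  weighted-yMinusPow {d = d} {φ} φ≤d (suc k) =
    ≡.subst (λ D → WeightedDegreeAtMost d D (yMinusPow φ (suc k))) (≡.sym (ℕ.*-suc d k))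
      (weighted-mulYMinus {L = yMinusPow φ k} φ≤d (weighted-yMinusPow φ≤d k))

  weighted-indicatorYPoly : ∀ {m d} {φ : Terms m} → All (λ t → degree t ≤ d) φ →
                            WeightedDegreeAtMost d (d ℕ.* (q ∸ 1)) (indicatorYPoly φ)
  weighted-indicatorYPoly {d = d} {φ} φ≤d b =
    coeffAt-⊕ (𝟙 ∷ []) (map ⊖_ (yMinusPow φ (q ∸ 1))) b (weighted-𝟙 d _ b)
      (≡.subst (All _) (≡.sym (coeffAt-map ⊖_ ≡.refl (yMinusPow φ (q ∸ 1)) b))
        (degree-⊖ {P = λ u → d ℕ.* b ℕ.+ u ≤ d ℕ.* (q ∸ 1)} (coeffAt (yMinusPow φ (q ∸ 1)) b)
          (weighted-yMinusPow φ≤d (q ∸ 1) b)))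

  ⨂ : ∀ {m n} → (Fin n → Terms m) → Terms m
  ⨂ {n = zero}  E = 𝟙
  ⨂ {n = suc n} E = E zero ⊛ ⨂ (E ∘ suc)

  ⟦⨂⟧ : ∀ {m n} (E : Fin n → Terms m) x → ⟦ ⨂ E ⟧ x ≈ ∏ᵢ (λ i → ⟦ E i ⟧ x)
  ⟦⨂⟧ {n = zero}  E x = ⟦𝟙⟧ x
  ⟦⨂⟧ {n = suc n} E x = trans (⟦⊛⟧ (E zero) (⨂ (E ∘ suc)) x) (*-congˡ (⟦⨂⟧ (E ∘ suc) x))

  degree-⨂ : ∀ {m n d D} (E : Fin n → Terms m) (β : Vec ℕ n) →
             (∀ i → All (λ t → d ℕ.* lookup β i ℕ.+ degree t ≤ D) (E i)) →
             All (λ t → d ℕ.* ∣ β ∣ₑ ℕ.+ degree t ≤ n ℕ.* D) (⨂ E)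
  degree-⨂ {d = d} E []      _   = weighted-𝟙 d 0 zero
  degree-⨂ {n = suc n} {d} {D} E (b ∷ β) E≤D =
    degree-⊛ {P = λ u → d ℕ.* b ℕ.+ u ≤ D} {Q = λ u → d ℕ.* ∣ β ∣ₑ ℕ.+ u ≤ n ℕ.* D}
             {R = λ u → d ℕ.* (b ℕ.+ ∣ β ∣ₑ) ℕ.+ u ≤ D ℕ.+ n ℕ.* D}
      (E zero) (⨂ (E ∘ suc)) (weight-add {d}) (E≤D zero) (degree-⨂ {d = d} (E ∘ suc) β (E≤D ∘ suc))

  ∑-coeffAt : ∀ {m} (L : YPoly m) N x y → length L ≤ N →
              ∑ (λ b → ⟦ coeffAt L b ⟧ x * y ^ b) (upTo N) ≈ ⟦ L ⟧ʸ x y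
  ∑-coeffAt []      N       x y _           = ∑-zero _ (upTo N) (λ b → zeroˡ _)
  ∑-coeffAt (E ∷ L) (suc N) x y (s≤s ∣L∣≤N) = begin
    ⟦ E ⟧ x * 1# + ∑ (λ b → ⟦ coeffAt (E ∷ L) b ⟧ x * y ^ b) (applyUpTo suc N)
                                                          ≈⟨ +-cong (*-identityʳ _) (∑-applyUpTo _ suc N) ⟩
    ⟦ E ⟧ x + ∑ (λ b → ⟦ coeffAt L b ⟧ x * (y * y ^ b)) (upTo N)
                                                          ≈⟨ +-congˡ (∑-cong (upTo N) (λ b → *-left-commutative _ y _)) ⟩
    ⟦ E ⟧ x + ∑ (λ b → y * (⟦ coeffAt L b ⟧ x * y ^ b)) (upTo N)
                                                          ≈⟨ +-congˡ (∑-distribˡ y _ (upTo N)) ⟨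
    ⟦ E ⟧ x + y * ∑ (λ b → ⟦ coeffAt L b ⟧ x * y ^ b) (upTo N)
                                                          ≈⟨ +-congˡ (*-congˡ (∑-coeffAt L N x y ∣L∣≤N)) ⟩
    ⟦ E ⟧ x + y * ⟦ L ⟧ʸ x y                              ∎

  sumR-map : ∀ (f : A → Carrier) xs → sumR F (map f xs) ≡ ∑ f xs
  sumR-map f []       = ≡.refl
  sumR-map f (x ∷ xs) = ≡.cong (f x +_) (sumR-map f xs)

  termsOf : ∀ {m} → Poly F m → Terms m
  termsOf {m} P = map (λ α → coeff P α ·x^ α) (filter (λ α → ¬? (coeff P α ≟ 0#)) (vecsOver (upTo (suc (bound P))) m))

  ⟦termsOf⟧ : ∀ {m} (P : Poly F m) x → ⟦ termsOf P ⟧ x ≈ eval F P x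
  ⟦termsOf⟧ {m} P x = begin
    ⟦ termsOf P ⟧ x                                       ≈⟨ ∑-map _ (λ α → coeff P α ·x^ α) (filter nonzero? box) ⟩
    ∑ (λ α → coeff P α * monomial F α x) (filter nonzero? box) ≈⟨ ∑-filter nonzero? _ box vanishing ⟩
    ∑ (λ α → coeff P α * monomial F α x) box                ≡⟨ sumR-map _ box ⟨
    eval F P x                                            ∎
    where
    box : List (Vec ℕ m)
    box = vecsOver (upTo (suc (bound P))) m
    nonzero? : Decidable (λ α → ¬ coeff P α ≈ 0#)
    nonzero? α = ¬? (coeff P α ≟ 0#)
    vanishing : ∀ α → ¬ ¬ coeff P α ≈ 0# → coeff P α * monomial F α x ≈ 0#
    vanishing α ¬¬zero = trans (*-congʳ (decidable-stable (coeff P α ≟ 0#) ¬¬zero)) (zeroˡ _)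

  degree-termsOf : ∀ {m d} (P : Poly F m) → DegreeAtMost F P d → All (λ t → degree t ≤ d) (termsOf P)
  degree-termsOf {m} P P≤d =
    AllP.map⁺ (All.map (λ {α} → P≤d α) (AllP.all-filter (λ α → ¬? (coeff P α ≟ 0#)) (vecsOver (upTo (suc (bound P))) m)))

  indicator-cong : ∀ {z z′} → z ≈ z′ → indicator z ≈ indicator z′
  indicator-cong z≈z′ = +-congˡ (-‿cong (^-cong (q ∸ 1) z≈z′))

  lookup-zeroVec : ∀ {n} (i : Fin n) → lookup (zeroVec F n) i ≡ 0#
  lookup-zeroVec zero    = ≡.refl
  lookup-zeroVec (suc i) = lookup-zeroVec i

  -- The polynomial supported on the image

  module _ {m n} (Φ : Fin n → Poly F m) where

    factor : Fin n → YPoly m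
    factor i = indicatorYPoly (termsOf (Φ i))

    yCoeff : Vec ℕ n → Terms m
    yCoeff β = ⨂ (λ i → coeffAt (factor i) (lookup β i))

    ⟦yCoeff⟧ : ∀ β x → ⟦ yCoeff β ⟧ x ≈ ∏ᵢ (λ i → ⟦ coeffAt (factor i) (lookup β i) ⟧ x)
    ⟦yCoeff⟧ β = ⟦⨂⟧ (λ i → coeffAt (factor i) (lookup β i))

    coeffAt-factor : ∀ i b → q ∸ 1 < b → coeffAt (factor i) b ≡ []
    coeffAt-factor i b q-1<b = coeffAt-length (factor i) b (ℕ.≤-trans (length-indicatorYPoly _) q-1<b)

    degree-yCoeff : ∀ {d} → (∀ i → DegreeAtMost F (Φ i) d) → ∀ β →
                    All (λ t → d ℕ.* ∣ β ∣ₑ ℕ.+ degree t ≤ n ℕ.* (d ℕ.* (q ∸ 1))) (yCoeff β)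
    degree-yCoeff {d} Φ≤d β = degree-⨂ {d = d} (λ i → coeffAt (factor i) (lookup β i)) β
      (λ i → weighted-indicatorYPoly (degree-termsOf (Φ i) (Φ≤d i)) (lookup β i))

    -- The coefficient of y^β in ∑_{x ∈ F^m} ∏_i (1 - (y_i - φ_i(x))^(q-1)).
    imageCoeff : Vec ℕ n → Carrier
    imageCoeff β = ∑ ⟦ yCoeff β ⟧ (points F m)

    imageCoeff-support : ∀ β → ¬ imageCoeff β ≈ 0# → ∀ j → lookup β j ≤ q ∸ 1
    imageCoeff-support β β≉0 j with lookup β j ℕ.≤? q ∸ 1
    ... | yes βj≤q-1 = βj≤q-1
    ... | no  βj≰q-1 = contradiction (∑-zero _ (points F m) λ x → trans (⟦yCoeff⟧ β x)
          (∏ᵢ-zero _ j (reflexive (≡.cong (λ E → ⟦ E ⟧ x) (coeffAt-factor j _ (ℕ.≰⇒> βj≰q-1)))))) β≉0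

    imageCoeff-degree : ∀ {d} → (∀ i → DegreeAtMost F (Φ i) d) → ∀ β → ¬ imageCoeff β ≈ 0# →
                        d ℕ.* ∣ β ∣ₑ ℕ.+ (q ∸ 1) ℕ.* m ≤ (q ∸ 1) ℕ.* (n ℕ.* d)
    imageCoeff-degree {d} Φ≤d β β≉0 with d ℕ.* ∣ β ∣ₑ ℕ.+ (q ∸ 1) ℕ.* m ℕ.≤? (q ∸ 1) ℕ.* (n ℕ.* d)
    ... | yes bound = bound
    ... | no  ≰     = contradiction
          (∑-⟦⟧≈0 (yCoeff β) (All.map (degree-gap d (q ∸ 1) m n (ℕ.≰⇒> ≰)) (degree-yCoeff Φ≤d β))) β≉0

    imagePoly : Poly F n
    imagePoly = record { coeff = imageCoeff ; bound = q ∸ 1 ; support = imageCoeff-support }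

    eval-imagePoly : ∀ y → eval F imagePoly y ≈ ∑ (λ x → ∏ᵢ (λ i → indicator (lookup y i - eval F (Φ i) x))) (points F m)
    eval-imagePoly y = begin
      eval F imagePoly y                                                    ≡⟨ sumR-map _ box ⟩
      ∑ (λ β → imageCoeff β * monomial F β y) box                           ≈⟨ ∑-cong box (λ β → ∑-distribʳ _ _ (points F m)) ⟩
      ∑ (λ β → ∑ (λ x → ⟦ yCoeff β ⟧ x * monomial F β y) (points F m)) box  ≈⟨ ∑-comm _ box (points F m) ⟩
      ∑ (λ x → ∑ (λ β → ⟦ yCoeff β ⟧ x * monomial F β y) box) (points F m)  ≈⟨ ∑-cong (points F m) expand ⟩
      ∑ (λ x → ∏ᵢ (λ i → indicator (lookup y i - eval F (Φ i) x))) (points F m) ∎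
      where
      box : List (Vec ℕ n)
      box = vecsOver (upTo (suc (q ∸ 1))) n

      term : Vec Carrier m → Fin n → ℕ → Carrier
      term x i b = ⟦ coeffAt (factor i) b ⟧ x * lookup y i ^ b

      split : ∀ x β → ⟦ yCoeff β ⟧ x * monomial F β y ≈ ∏ᵢ (λ i → term x i (lookup β i))
      split x β = trans (*-cong (⟦yCoeff⟧ β x) (monomial≈∏ᵢ β y))
        (sym (∏ᵢ-* (λ i → ⟦ coeffAt (factor i) (lookup β i) ⟧ x) (λ i → lookup y i ^ lookup β i)))

      expand : ∀ x → ∑ (λ β → ⟦ yCoeff β ⟧ x * monomial F β y) box ≈ ∏ᵢ (λ i → indicator (lookup y i - eval F (Φ i) x))
      expand x = begin
        ∑ (λ β → ⟦ yCoeff β ⟧ x * monomial F β y) box        ≈⟨ ∑-cong box (split x) ⟩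
        ∑ (λ β → ∏ᵢ (λ i → term x i (lookup β i))) box      ≈⟨ ∑-vecsOver-∏ᵢ (upTo (suc (q ∸ 1))) (term x) ⟩
        ∏ᵢ (λ i → ∑ (term x i) (upTo (suc (q ∸ 1))))        ≈⟨ ∏ᵢ-cong (λ i → ∑-coeffAt (factor i) _ x (lookup y i)
                                                                                  (length-indicatorYPoly _)) ⟩
        ∏ᵢ (λ i → ⟦ factor i ⟧ʸ x (lookup y i))             ≈⟨ ∏ᵢ-cong (λ i → ⟦indicatorYPoly⟧ʸ _ x (lookup y i)) ⟩
        ∏ᵢ (λ i → indicator (lookup y i - ⟦ termsOf (Φ i) ⟧ x))
                                                            ≈⟨ ∏ᵢ-cong (λ i → indicator-cong (+-congˡ (-‿cong (⟦termsOf⟧ (Φ i) x)))) ⟩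
        ∏ᵢ (λ i → indicator (lookup y i - eval F (Φ i) x))  ∎

    ∏ᵢ-indicator-≈1 : ∀ x y → (∀ i → eval F (Φ i) x ≈ lookup y i) →
                      ∏ᵢ (λ i → indicator (lookup y i - eval F (Φ i) x)) ≈ 1#
    ∏ᵢ-indicator-≈1 x y Φx≈y = ∏ᵢ-one _ (λ i → indicator-≈0 (x≈y⇒x∙y⁻¹≈ε (sym (Φx≈y i))))

    ∏ᵢ-indicator-≈0 : ∀ x y → ¬ (∀ i → eval F (Φ i) x ≈ lookup y i) →
                      ∏ᵢ (λ i → indicator (lookup y i - eval F (Φ i) x)) ≈ 0#
    ∏ᵢ-indicator-≈0 x y Φx≉y with ¬∀⟶∃¬ n _ (λ i → eval F (Φ i) x ≟ lookup y i) Φx≉y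
    ... | i , Φᵢx≉yᵢ = ∏ᵢ-zero _ i (indicator-≉0 (λ yᵢ-Φᵢx≈0 → Φᵢx≉yᵢ (sym (x∙y⁻¹≈ε⇒x≈y _ _ yᵢ-Φᵢx≈0))))

    imagePoly-vanishes : ∀ y → ¬ InImage F Φ y → eval F imagePoly y ≈ 0#
    imagePoly-vanishes y y∉imΦ = trans (eval-imagePoly y)
      (∑-zero _ (points F m) (λ x → ∏ᵢ-indicator-≈0 x y (λ Φx≈y → y∉imΦ (x , Φx≈y))))

    imagePoly-at-0 : eval F imagePoly (zeroVec F n) ≈ zeroCount F Φ × 1#
    imagePoly-at-0 = trans (eval-imagePoly (zeroVec F n))
      (∑-indicator (λ x → all? (λ i → eval F (Φ i) x ≟ 0#)) _ (points F m)
        (λ x Φx≈0 → ∏ᵢ-indicator-≈1 x (zeroVec F n) (λ i → trans (Φx≈0 i) (0≈zeroVec i)))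
        (λ x Φx≉0 → ∏ᵢ-indicator-≈0 x (zeroVec F n) (λ Φx≈0 → Φx≉0 (λ i → trans (Φx≈0 i) (sym (0≈zeroVec i))))))
      where
      0≈zeroVec : ∀ i → 0# ≈ lookup (zeroVec F n) i
      0≈zeroVec i = reflexive (≡.sym (lookup-zeroVec i))


open import Data.Nat using (_+_; _*_)
open import Data.Product using (_×_)

lemma3p1 : ∀ {c ℓ : Level} (q : ℕ) → IsPrimePower q → (F : FiniteField c ℓ q) →
           (m n d : ℕ) → 0 < m → 0 < n → 0 < d →
           (Φ : Fin n → Poly F m) →
           (∀ i → DegreeAtMost F (Φ i) d) →
           Coprime (zeroCount F Φ) q →
           ∃ λ (P : Poly F n) →
             IndividualDegreeAtMost F P (q ∸ 1)
             × (∀ α → ¬ (FiniteField._≈_ F (Poly.coeff P α) (FiniteField.0# F)) →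
                  d * ∣ α ∣ₑ + (q ∸ 1) * m ≤ (q ∸ 1) * (n * d))
             × (∀ (y : Vec (FiniteField.Carrier F) n) → ¬ InImage F Φ y →
                  FiniteField._≈_ F (eval F P y) (FiniteField.0# F))
             × ¬ (FiniteField._≈_ F (eval F P (zeroVec F n)) (FiniteField.0# F))
lemma3p1 q _ F m n d _ _ _ Φ Φ≤d coprime =
  imagePoly F Φ , imageCoeff-support F Φ , imageCoeff-degree F Φ Φ≤d , imagePoly-vanishes F Φ ,
  λ P[0]≈0 → coprime⇒×1≉0 F coprime (FiniteField.trans F (FiniteField.sym F (imagePoly-at-0 F Φ)) P[0]≈0)
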